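{- Let $C_5$ be a set of five points in convex and general position in the plane, and let $\gamma$ be a coloring of $D(C_5)$ with three colors. Then at most two points of $C_5$ are apices of stars of $\gamma$.
   Context: $D(P)$ is the graph whose vertices are the closed segments with both endpoints in $P$, adjacent iff disjoint; a coloring of $D(P)$ is an assignment of colors to these segments such that any two segments of the same color cross or share an endpoint. A chromatic class (set of segments of one color) is a star if no two of its segments cross. An apex of a star is a point incident with all segments of the star; if a star consists of a single segment, both its endpoints are apices. -}

module Defs where

open import Data.Nat using (ℕ; _<_)
open import Data.Fin using (Fin; toℕ)
open import Data.Product using (Σ; ∃; _×_; _,_)
open import Data.Sum using (_⊎_)
open import Relation.Nullary using (¬_)
open import Relation.Binary.PropositionalEquality using (_≡_; _≢_)

-- Only the cyclic order of
-- the points along the convex hull matters for D(C₅), so the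
-- points are labelled 0,1,2,3,4 in their cyclic order around the hull.
Point : Set
Point = Fin 5

-- A closed segment with both endpoints in C₅: an unordered pair of distinct
-- points, stored with its endpoints in increasing label order.
record Segment : Set where
  constructor seg
  field
    a b  : Point
    a<b  : toℕ a < toℕ b
open Segment public

Incident : Point → Segment → Set
Incident p s = p ≡ a s ⊎ p ≡ b s

ShareEndpoint : Segment → Segment → Set
ShareEndpoint s t = Σ Point λ p → Incident p s × Incident p t

-- For points in convex and general position, two segments cross (their
-- relative interiors meet) iff their four endpoints are distinct and
-- interleave in the cyclic order.
Cross : Segment → Segment → Set
Cross s t =
    (toℕ (a s) < toℕ (a t) × toℕ (a t) < toℕ (b s) × toℕ (b s) < toℕ (b t))
  ⊎ (toℕ (a t) < toℕ (a s) × toℕ (a s) < toℕ (b t) × toℕ (b t) < toℕ (b s))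

-- adjacency in D(C₅): the closed segments are disjoint
Disjoint : Segment → Segment → Set
Disjoint s t = ¬ ShareEndpoint s t × ¬ Cross s t

IsColoring : (k : ℕ) → (Segment → Fin k) → Set
IsColoring k γ = ∀ s t → γ s ≡ γ t → ¬ Disjoint s t

-- the chromatic class of color c (nonempty: a class of a color actually used)
-- is a star: no two of its segments cross
IsStar : {k : ℕ} → (Segment → Fin k) → Fin k → Set
IsStar γ c = (∃ λ s → γ s ≡ c) × (∀ s t → γ s ≡ c → γ t ≡ c → ¬ Cross s t)

IsApexOf : {k : ℕ} → (Segment → Fin k) → Fin k → Point → Set
IsApexOf γ c p = IsStar γ c × (∀ s → γ s ≡ c → Incident p s)

IsApex : {k : ℕ} → (Segment → Fin k) → Point → Set
IsApex γ p = ∃ λ c → IsApexOf γ c p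

{-# OPTIONS --safe #-}
-- A segment avoiding an apex p of colour c is not coloured c. If the three
-- apices have three distinct colours, the segment through the two remaining
-- points gets none of them. Three apices cannot share a colour, as the star
-- would consist of segments through three points. If p, q share a colour and r
-- has another, every segment avoiding q and r and every segment avoiding p and r
-- has the third colour; but two such segments are disjoint.
module Submission where

open import Defs
open import Data.Empty using (⊥; ⊥-elim)
open import Data.Fin using (Fin; toℕ)
open import Data.Fin.Patterns using (0F; 1F; 2F; 3F; 4F)
open import Data.Fin.Properties using (_≟_; all?; any?)
open import Data.List using (List; []; _∷_)
open import Data.List.Relation.Unary.Any as Any using (Any; satisfied)
open import Data.Nat using (_<_)
open import Data.Nat.Properties using (_<?_)
open import Data.Product using (_×_; _,_; ∃; ∃₂)
open import Data.Sum using (_⊎_; inj₁; inj₂)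
open import Relation.Nullary using (¬_; Dec; yes; no; ¬?)
open import Relation.Nullary.Decidable using (True; toWitness; _×-dec_; _⊎-dec_; _→-dec_)
open import Relation.Binary.PropositionalEquality using (_≡_; _≢_; refl; sym; ≢-sym)

incident? : ∀ p s → Dec (Incident p s)
incident? p s = (p ≟ a s) ⊎-dec (p ≟ b s)

shareEndpoint? : ∀ s t → Dec (ShareEndpoint s t)
shareEndpoint? s t = any? λ p → incident? p s ×-dec incident? p t

interleaved? : (w x y z : Point) → Dec (toℕ w < toℕ x × toℕ x < toℕ y × toℕ y < toℕ z)
interleaved? w x y z = (toℕ w <? toℕ x) ×-dec (toℕ x <? toℕ y) ×-dec (toℕ y <? toℕ z)

cross? : ∀ s t → Dec (Cross s t)
cross? s t = interleaved? (a s) (a t) (b s) (b t) ⊎-dec interleaved? (a t) (a s) (b t) (b s)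

disjoint? : ∀ s t → Dec (Disjoint s t)
disjoint? s t = ¬? (shareEndpoint? s t) ×-dec ¬? (cross? s t)

segment : (x y : Point) → {True (toℕ x <? toℕ y)} → Segment
segment x y {x<y} = seg x y (toWitness x<y)

segments : List Segment
segments = segment 0F 1F ∷ segment 0F 2F ∷ segment 0F 3F ∷ segment 0F 4F ∷ segment 1F 2F
         ∷ segment 1F 3F ∷ segment 1F 4F ∷ segment 2F 3F ∷ segment 2F 4F ∷ segment 3F 4F ∷ []

ForDistinct : (Point → Point → Point → Set) → Set
ForDistinct P = ∀ p q r → p ≢ q → p ≢ r → q ≢ r → P p q r

forDistinct? : {P : Point → Point → Point → Set} →
               (∀ p q r → Dec (P p q r)) → Dec (ForDistinct P)
forDistinct? P? = all? λ p → all? λ q → all? λ r →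
  ¬? (p ≟ q) →-dec ¬? (p ≟ r) →-dec ¬? (q ≟ r) →-dec P? p q r

-- The exhaustive searches below are sealed so that `with` over their results
-- does not make the type checker unfold them.
opaque
  segment-avoiding : ForDistinct λ p q r →
    ∃ λ s → ¬ Incident p s × ¬ Incident q s × ¬ Incident r s
  segment-avoiding p q r p≢q p≢r q≢r = satisfied (found p q r p≢q p≢r q≢r)
    where
    found : ForDistinct λ p q r →
      Any (λ s → ¬ Incident p s × ¬ Incident q s × ¬ Incident r s) segments
    found = toWitness {a? = forDistinct? λ p q r →
      Any.any? (λ s → ¬? (incident? p s) ×-dec ¬? (incident? q s) ×-dec ¬? (incident? r s)) segments} _

-- With x, y the two remaining points, of the matchings {px, qy} and {py, qx}
-- of four points in convex position at most one crosses; the other is the pair u, v.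
opaque
  disjoint-segments-avoiding : ForDistinct λ p q r →
    ∃₂ λ u v → ¬ Incident q u × ¬ Incident r u × ¬ Incident p v × ¬ Incident r v × Disjoint u v
  disjoint-segments-avoiding p q r p≢q p≢r q≢r =
    let u , q∉u , r∉u , v∈segments = satisfied (found p q r p≢q p≢r q≢r)
        v , p∉v , r∉v , u#v = satisfied v∈segments
    in u , v , q∉u , r∉u , p∉v , r∉v , u#v
    where
    found : ForDistinct λ p q r → Any (λ u → ¬ Incident q u × ¬ Incident r u ×
      Any (λ v → ¬ Incident p v × ¬ Incident r v × Disjoint u v) segments) segments
    found = toWitness {a? = forDistinct? λ p q r → Any.any? (λ u →
      ¬? (incident? q u) ×-dec ¬? (incident? r u) ×-dec
      Any.any? (λ v → ¬? (incident? p v) ×-dec ¬? (incident? r v) ×-dec disjoint? u v) segments) segments} _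

incident-at-most-two : ∀ {p q r s} → p ≢ q → p ≢ r → q ≢ r →
  Incident p s → Incident q s → ¬ Incident r s
incident-at-most-two p≢q _ _ (inj₁ refl) (inj₁ refl) _ = p≢q refl
incident-at-most-two p≢q _ _ (inj₂ refl) (inj₂ refl) _ = p≢q refl
incident-at-most-two _ p≢r _ (inj₁ refl) (inj₂ refl) (inj₁ refl) = p≢r refl
incident-at-most-two _ _ q≢r (inj₁ refl) (inj₂ refl) (inj₂ refl) = q≢r refl
incident-at-most-two _ _ q≢r (inj₂ refl) (inj₁ refl) (inj₁ refl) = q≢r refl
incident-at-most-two _ p≢r _ (inj₂ refl) (inj₁ refl) (inj₂ refl) = p≢r refl

opaque
  distinct-cover-Fin3 : ∀ {c₁ c₂ c₃ : Fin 3} → c₁ ≢ c₂ → c₁ ≢ c₃ → c₂ ≢ c₃ →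
    ∀ x → x ≡ c₁ ⊎ x ≡ c₂ ⊎ x ≡ c₃
  distinct-cover-Fin3 {c₁} {c₂} {c₃} = toWitness {a? = all? λ c₁ → all? λ c₂ → all? λ c₃ →
    ¬? (c₁ ≟ c₂) →-dec ¬? (c₁ ≟ c₃) →-dec ¬? (c₂ ≟ c₃) →-dec
    all? λ x → (x ≟ c₁) ⊎-dec (x ≟ c₂) ⊎-dec (x ≟ c₃)} _ c₁ c₂ c₃

third-colour-unique : ∀ {c d x y : Fin 3} → c ≢ d →
  x ≢ c → x ≢ d → y ≢ c → y ≢ d → x ≡ y
third-colour-unique c≢d x≢c x≢d y≢c y≢d
  with distinct-cover-Fin3 c≢d (≢-sym x≢c) (≢-sym x≢d) _
... | inj₁ y≡c        = ⊥-elim (y≢c y≡c)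
... | inj₂ (inj₁ y≡d) = ⊥-elim (y≢d y≡d)
... | inj₂ (inj₂ y≡x) = sym y≡x

module _ {k} {γ : Segment → Fin k} where

  apex-avoided : ∀ {c p s} → IsApexOf γ c p → ¬ Incident p s → γ s ≢ c
  apex-avoided (_ , p-on-class) p∉s γs≡c = p∉s (p-on-class _ γs≡c)

  apices-of-one-colour-at-most-two : ∀ {c p q r} → p ≢ q → p ≢ r → q ≢ r →
    IsApexOf γ c p → IsApexOf γ c q → IsApexOf γ c r → ⊥
  apices-of-one-colour-at-most-two p≢q p≢r q≢r
    (((w , γw≡c) , _) , p-on-class) (_ , q-on-class) (_ , r-on-class) =
    incident-at-most-two {s = w} p≢q p≢r q≢r
      (p-on-class w γw≡c) (q-on-class w γw≡c) (r-on-class w γw≡c)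

module _ {γ : Segment → Fin 3} {p q r : Point} (p≢q : p ≢ q) (p≢r : p ≢ r) (q≢r : q ≢ r) where

  apices-of-distinct-colours : ∀ {c₁ c₂ c₃} → c₁ ≢ c₂ → c₁ ≢ c₃ → c₂ ≢ c₃ →
    IsApexOf γ c₁ p → IsApexOf γ c₂ q → IsApexOf γ c₃ r → ⊥
  apices-of-distinct-colours c₁≢c₂ c₁≢c₃ c₂≢c₃ p-apex q-apex r-apex
    with segment-avoiding p q r p≢q p≢r q≢r
  ... | s , p∉s , q∉s , r∉s with distinct-cover-Fin3 c₁≢c₂ c₁≢c₃ c₂≢c₃ (γ s)
  ... | inj₁ γs≡c₁        = apex-avoided p-apex p∉s γs≡c₁
  ... | inj₂ (inj₁ γs≡c₂) = apex-avoided q-apex q∉s γs≡c₂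
  ... | inj₂ (inj₂ γs≡c₃) = apex-avoided r-apex r∉s γs≡c₃

  apices-sharing-colour : IsColoring 3 γ → ∀ {c d} →
    IsApexOf γ c p → IsApexOf γ c q → IsApexOf γ d r → ⊥
  apices-sharing-colour col {c} {d} p-apex q-apex r-apex with c ≟ d
  ... | yes refl = apices-of-one-colour-at-most-two p≢q p≢r q≢r p-apex q-apex r-apex
  ... | no c≢d with disjoint-segments-avoiding p q r p≢q p≢r q≢r
  ... | u , v , q∉u , r∉u , p∉v , r∉v , u#v =
    col u v (third-colour-unique c≢d
              (apex-avoided q-apex q∉u) (apex-avoided r-apex r∉u)
              (apex-avoided p-apex p∉v) (apex-avoided r-apex r∉v)) u#v

proposition7 : (γ : Segment → Fin 3) → IsColoring 3 γ →
    (p q r : Point) → p ≢ q → p ≢ r → q ≢ r →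
    ¬ (IsApex γ p × IsApex γ q × IsApex γ r)
proposition7 γ col p q r p≢q p≢r q≢r ((cp , p-apex) , (cq , q-apex) , (cr , r-apex))
  with cp ≟ cq | cp ≟ cr | cq ≟ cr
... | yes refl | _        | _        = apices-sharing-colour p≢q p≢r q≢r col p-apex q-apex r-apex
... | no _     | yes refl | _        = apices-sharing-colour p≢r p≢q (≢-sym q≢r) col p-apex r-apex q-apex
... | no _     | no _     | yes refl = apices-sharing-colour q≢r (≢-sym p≢q) (≢-sym p≢r) col q-apex r-apex p-apex
... | no cp≢cq | no cp≢cr | no cq≢cr = apices-of-distinct-colours p≢q p≢r q≢r cp≢cq cp≢cr cq≢cr p-apex q-apex r-apex
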